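{- Let $n \geq 6$ be even and let $G_0=(V,E)$ be a graph on $n$ vertices. Suppose there are vertices $x,y,z \in V$ with $xy \in E$, $d_{G_0}(x)=d_{G_0}(y)=1$ and $d_{G_0}(z)=0$, such that $G_0\setminus\{x,y,z\}$ has a Hamilton cycle. If Max is the second player, then $s(G_0,\mathcal{PM}) \geq \binom{n-3}{2}$.
   Context: $\mathcal{PM}$ is the property of admitting a perfect matching. For a graph $H$ on $n$ vertices not in $\mathcal{PM}$, the saturation game $(H,\mathcal{PM})$ is played as follows. Starting with $G=H$, two players, Mini and Max, alternately add to $G$ an edge $e \notin E(G)$ such that $G\cup\{e\}$ has no perfect matching. The game ends when no such edge exists. Max wants to maximize and Mini to minimize the final number of edges. The score $s(H,\mathcal{PM})$ is the number of edges of the final graph under optimal play. $G_0\setminus S$ denotes the graph obtained by deleting the vertex set $S$. -}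

module Defs where

open import Data.Nat using (ℕ; zero; suc; _≤_)
open import Data.Bool using (Bool; true; false; _∨_; _∧_; if_then_else_)
open import Data.Fin using (Fin; zero; suc; inject₁; fromℕ; _<_; _≟_; _<?_)
open import Data.List using (List; map; allFin)
open import Data.Nat.ListAction using (sum)
open import Data.Product using (Σ; ∃; _×_; _,_)
open import Relation.Nullary using (¬_; does)
open import Relation.Binary.PropositionalEquality using (_≡_; _≢_)

-- A graph on vertex set Fin n, given by its adjacency (Bool-valued) relation.
-- Simplicity (symmetry, irreflexivity) is imposed as a hypothesis where needed;
-- addEdge preserves it.
Graph : ℕ → Set
Graph n = Fin n → Fin n → Bool

Symmetric : ∀ {n} → Graph n → Set
Symmetric {n} G = ∀ (i j : Fin n) → G i j ≡ G j i

Irreflexive : ∀ {n} → Graph n → Set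
Irreflexive {n} G = ∀ (i : Fin n) → G i i ≡ false

addEdge : ∀ {n} → Graph n → Fin n → Fin n → Graph n
addEdge G u v i j =
  G i j ∨ ((does (i ≟ u) ∧ does (j ≟ v)) ∨ (does (i ≟ v) ∧ does (j ≟ u)))

edgeCount : ∀ {n} → Graph n → ℕ
edgeCount {n} G =
  sum (map (λ i → sum (map (λ j → if does (i <? j) ∧ G i j then 1 else 0)
                            (allFin n)))
           (allFin n))

degree : ∀ {n} → Graph n → Fin n → ℕ
degree {n} G x = sum (map (λ j → if G x j then 1 else 0) (allFin n))

record PerfectMatching {n} (G : Graph n) : Set where
  field
    partner   : Fin n → Fin n
    involutive : ∀ i → partner (partner i) ≡ i
    noFixed   : ∀ i → partner i ≢ i
    adjacent  : ∀ i → G i (partner i) ≡ true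

HasPM : ∀ {n} → Graph n → Set
HasPM G = PerfectMatching G

record HamCycleAvoiding {n} (G : Graph n) (x y z : Fin n) : Set where
  field
    k      : ℕ
    h      : Fin (suc k) → Fin n
    inj    : ∀ i j → h i ≡ h j → i ≡ j
    avoid  : ∀ i → (h i ≢ x) × (h i ≢ y) × (h i ≢ z)
    cover  : ∀ v → v ≢ x → v ≢ y → v ≢ z → ∃ λ i → h i ≡ v
    path   : ∀ (i : Fin k) → G (h (inject₁ i)) (h (suc i)) ≡ true
    close  : G (h (fromℕ k)) (h zero) ≡ true

data Player : Set where
  mini maxi : Player

Legal : ∀ {n} → Graph n → Fin n → Fin n → Set
Legal G u v = (u < v) × (G u v ≡ false) × ¬ HasPM (addEdge G u v)

Saturated : ∀ {n} → Graph n → Set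
Saturated {n} G = ∀ (u v : Fin n) → ¬ Legal G u v

-- MaxForces k p G : in the game position G with player p to move, Max has a
-- strategy guaranteeing that the final graph has at least k edges
-- (equivalently: the minimax score of the position is ≥ k).
data MaxForces {n} (k : ℕ) : Player → Graph n → Set where
  done     : ∀ {p G} → Saturated G → k ≤ edgeCount G → MaxForces k p G
  maxMove  : ∀ {G} u v → Legal G u v → MaxForces k mini (addEdge G u v)
           → MaxForces k maxi G
  miniMove : ∀ {G} → (∃ λ u → ∃ λ v → Legal G u v)
           → (∀ u v → Legal G u v → MaxForces k maxi (addEdge G u v))
           → MaxForces k mini G

ScoreAtLeast : ∀ {n} → Player → Graph n → ℕ → Set
ScoreAtLeast first H k = MaxForces k first H

-- W = V ∖ {x, y, z} carries the Hamilton cycle, so |W| = n − 3 is odd. A supergraph of G₀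
-- has a perfect matching exactly when z can be matched without stranding x or y: z has a
-- neighbour w in W, or z ~ x and y has a neighbour w in W, or z ~ y and x has a neighbour w
-- in W. Sufficiency: match x y z and w among themselves as indicated; deleting w from the odd
-- cycle leaves a path on an even number of vertices, which is matched along its edges.
-- Necessity: follow the partner of z, and then that of x or y. The condition only involves
-- the rows of x, y and z, so adding an edge inside W never creates a perfect matching.
-- Hence every saturated position of the game contains a clique on W, with (n − 3 choose 2)
-- edges, however the two players move.
module Submission where

open import Defs
open import Data.Bool using (Bool; true; false; not; _∧_; _∨_; if_then_else_)
open import Data.Bool.Properties as Boolₚ using (∧-identityʳ; ∨-zeroʳ; ∨-identityʳ; ∨-comm; ∧-comm; ¬-not)
open import Data.Empty using (⊥-elim)
open import Data.Fin as Fin using (Fin; zero; suc; toℕ; fromℕ; fromℕ<; inject₁; _≟_; _<?_)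
open import Data.Fin.Properties as Finₚ
  using (toℕ-injective; toℕ-fromℕ<; toℕ-fromℕ; toℕ-inject₁; toℕ<n; any?; <-cmp; <⇒≢)
open import Data.List using (map; allFin; tabulate)
open import Data.List.Properties using (map-tabulate; tabulate-cong)
open import Data.Nat using (ℕ; zero; suc; _+_; _*_; _≤_; _<_; _∸_; z≤n; s≤s; z<s; s≤s⁻¹; NonZero)
open import Data.Nat.Combinatorics using (_C_; nC1≡n; nCk+nC[k+1]≡[n+1]C[k+1])
open import Data.Nat.DivMod
  using (_%_; _/_; _mod_; m≡m%n+[m/n]*n; /-monoˡ-≤; [m+n]%n≡m%n; [m+kn]%n≡m%n; n%n≡0; m%n<n; m<n⇒m%n≡m)
open import Data.Nat.Divisibility using (_∣_; divides; ∣m+n∣m⇒∣n)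
open import Data.Nat.ListAction using (sum)
open import Data.Nat.Properties as ℕₚ hiding (_≟_; _<?_; <-cmp; <⇒≢)
open import Algebra.Properties.CommutativeSemigroup ℕₚ.+-commutativeSemigroup using (x∙yz≈y∙xz)
open import Data.Product using (∃; _×_; _,_; proj₁; proj₂)
open import Data.Sum using (_⊎_; inj₁; inj₂)
open import Data.Unit using (⊤; tt)
open import Function using (id; _∘_; case_of_)
open import Function.Definitions using (Injective)
open import Level using (0ℓ)
open import Relation.Binary using (tri<; tri≈; tri>)
open import Relation.Binary.PropositionalEquality
open import Relation.Nullary using (¬_; Dec; does; yes; no; ¬?; _×-dec_; _⊎-dec_; contradiction)
open import Relation.Nullary.Decidable using (dec-true; dec-false; map′)
open import Relation.Unary using (Pred; Decidable; _⊆_)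

-- Finite sums and counting

∑ : ∀ {n} → (Fin n → ℕ) → ℕ
∑ f = sum (tabulate f)

sum-map-allFin : ∀ {n} (f : Fin n → ℕ) → sum (map f (allFin n)) ≡ ∑ f
sum-map-allFin {n} f = cong sum (map-tabulate id f)

∑-cong : ∀ {n} {f g : Fin n → ℕ} → (∀ i → f i ≡ g i) → ∑ f ≡ ∑ g
∑-cong f≗g = cong sum (tabulate-cong f≗g)

∑-mono-≤ : ∀ {n} {f g : Fin n → ℕ} → (∀ i → f i ≤ g i) → ∑ f ≤ ∑ g
∑-mono-≤ {zero}  f≤g = z≤n
∑-mono-≤ {suc n} f≤g = +-mono-≤ (f≤g zero) (∑-mono-≤ (f≤g ∘ suc))

∑-mono-< : ∀ {n} {f g : Fin n → ℕ} → (∀ i → f i ≤ g i) → ∀ a → f a < g a → ∑ f < ∑ g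
∑-mono-< {suc n} f≤g zero    fa<ga = +-mono-<-≤ fa<ga (∑-mono-≤ (f≤g ∘ suc))
∑-mono-< {suc n} f≤g (suc a) fa<ga = +-mono-≤-< (f≤g zero) (∑-mono-< (f≤g ∘ suc) a fa<ga)

∑≡0⇒≡0 : ∀ {n} (f : Fin n → ℕ) → ∑ f ≡ 0 → ∀ i → f i ≡ 0
∑≡0⇒≡0 f ∑f≡0 zero    = m+n≡0⇒m≡0 (f zero) ∑f≡0
∑≡0⇒≡0 f ∑f≡0 (suc i) = ∑≡0⇒≡0 (f ∘ suc) (m+n≡0⇒n≡0 (f zero) ∑f≡0) i

ind : Bool → ℕ
ind b = if b then 1 else 0

count : ∀ {n} {P : Pred (Fin n) 0ℓ} → Decidable P → ℕ
count P? = ∑ (λ v → ind (does (P? v)))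

does-⇔ : ∀ {A B : Set} (a? : Dec A) (b? : Dec B) → (A → B) → (B → A) → does a? ≡ does b?
does-⇔ (yes a) b? to from = sym (dec-true b? (to a))
does-⇔ (no ¬a) b? to from = sym (dec-false b? (¬a ∘ from))

count-cong : ∀ {n} {P Q : Pred (Fin n) 0ℓ} (P? : Decidable P) (Q? : Decidable Q) →
  (∀ {v} → P v → Q v) → (∀ {v} → Q v → P v) → count P? ≡ count Q?
count-cong P? Q? to from = ∑-cong λ v → cong ind (does-⇔ (P? v) (Q? v) to from)

count-full : ∀ n → count {n} {λ _ → ⊤} (λ _ → yes tt) ≡ n
count-full zero    = refl
count-full (suc n) = cong suc (count-full n)

count-empty : ∀ {n} {P : Pred (Fin n) 0ℓ} (P? : Decidable P) → (∀ v → ¬ P v) → count P? ≡ 0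
count-empty {zero}  P? ¬P = refl
count-empty {suc n} P? ¬P rewrite dec-false (P? zero) (¬P zero) = count-empty (P? ∘ suc) (¬P ∘ suc)

infixl 6 _∖?_

_∖?_ : ∀ {n} {P : Pred (Fin n) 0ℓ} → Decidable P → (a : Fin n) → Decidable (λ v → P v × ¬ v ≡ a)
(P? ∖? a) v = P? v ×-dec ¬? (v ≟ a)

count-remove : ∀ {n} {P : Pred (Fin n) 0ℓ} (P? : Decidable P) {a} → P a → count P? ≡ suc (count (P? ∖? a))
count-remove {suc n} P? {zero} Pa rewrite dec-true (P? zero) Pa =
  cong suc (∑-cong λ v → cong ind (sym (∧-identityʳ (does (P? (suc v))))))
count-remove {suc n} P? {suc a} Pa = begin
  ind (does (P? zero)) + count (P? ∘ suc)
    ≡⟨ cong (ind (does (P? zero)) +_) (count-remove (P? ∘ suc) Pa) ⟩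
  ind (does (P? zero)) + suc (count ((P? ∘ suc) ∖? a))
    ≡⟨ +-suc _ _ ⟩
  suc (ind (does (P? zero)) + count ((P? ∘ suc) ∖? a))
    ≡⟨ cong (λ b → suc (ind b + count ((P? ∘ suc) ∖? a))) (sym (∧-identityʳ (does (P? zero)))) ⟩
  suc (count (P? ∖? suc a)) ∎
  where open ≡-Reasoning

count-image : ∀ m {n} {P : Pred (Fin n) 0ℓ} (P? : Decidable P) (g : Fin m → Fin n) →
  Injective _≡_ _≡_ g → (∀ i → P (g i)) → (∀ {v} → P v → ∃ λ i → g i ≡ v) → count P? ≡ m
count-image zero    P? g inj into onto = count-empty P? λ v Pv → case onto Pv of λ ()
count-image (suc m) {P = P} P? g inj into onto =
  trans (count-remove P? (into zero))
        (cong suc (count-image m (P? ∖? g zero) (g ∘ suc) (Finₚ.suc-injective ∘ inj) into′ onto′))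
  where
  into′ : ∀ i → P (g (suc i)) × ¬ g (suc i) ≡ g zero
  into′ i = into (suc i) , λ e → case inj e of λ ()
  onto′ : ∀ {v} → P v × ¬ v ≡ g zero → ∃ λ i → g (suc i) ≡ v
  onto′ (Pv , v≢g₀) with onto Pv
  ... | zero  , refl = contradiction refl v≢g₀
  ... | suc i , gi≡v = i , gi≡v

∑-zero : ∀ n → ∑ {n} (λ _ → 0) ≡ 0
∑-zero zero    = refl
∑-zero (suc n) = ∑-zero n

pairs : ∀ {n} {P : Pred (Fin n) 0ℓ} → Decidable P → ℕ
pairs P? = ∑ (λ i → ∑ (λ j → ind (does (i <? j) ∧ (does (P? i) ∧ does (P? j)))))

pairs≡countC2 : ∀ {n} {P : Pred (Fin n) 0ℓ} (P? : Decidable P) → pairs P? ≡ count P? C 2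
pairs≡countC2 {zero}  P? = refl
pairs≡countC2 {suc n} P? with P? zero
... | no _  = trans (cong (_+ pairs (P? ∘ suc)) (∑-zero n)) (pairs≡countC2 (P? ∘ suc))
... | yes _ = begin
  c + pairs (P? ∘ suc) ≡⟨ cong (c +_) (pairs≡countC2 (P? ∘ suc)) ⟩
  c + c C 2            ≡⟨ cong (_+ c C 2) (sym (nC1≡n c)) ⟩
  c C 1 + c C 2        ≡⟨ nCk+nC[k+1]≡[n+1]C[k+1] c 1 ⟩
  suc c C 2            ∎
  where
  open ≡-Reasoning
  c : ℕ
  c = count (P? ∘ suc)

-- Edge counts and the saturation game

module _ {n} {G : Graph n} where

  addEdge-⊇ : ∀ u v {i j} → G i j ≡ true → addEdge G u v i j ≡ true
  addEdge-⊇ u v Gij rewrite Gij = refl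

  addEdge-new : ∀ u v → addEdge G u v u v ≡ true
  addEdge-new u v rewrite dec-true (u ≟ u) refl | dec-true (v ≟ v) refl = ∨-zeroʳ (G u v)

  addEdge-symmetric : Symmetric G → ∀ u v → Symmetric (addEdge G u v)
  addEdge-symmetric symG u v i j =
    cong₂ _∨_ (symG i j) (trans (∨-comm (iu ∧ jv) (iv ∧ ju)) (cong₂ _∨_ (∧-comm iv ju) (∧-comm iu jv)))
    where
    iu jv iv ju : Bool
    iu = does (i ≟ u)
    jv = does (j ≟ v)
    iv = does (i ≟ v)
    ju = does (j ≟ u)

  addEdge-row : ∀ {u v r} → r ≢ u → r ≢ v → ∀ s → addEdge G u v r s ≡ G r s
  addEdge-row {u} {v} {r} r≢u r≢v s
    rewrite dec-false (r ≟ u) r≢u | dec-false (r ≟ v) r≢v = ∨-identityʳ (G r s)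

edgeCount≡∑ : ∀ {n} (G : Graph n) → edgeCount G ≡ ∑ (λ i → ∑ (λ j → ind (does (i <? j) ∧ G i j)))
edgeCount≡∑ {n} G =
  trans (sum-map-allFin (λ i → sum (map (row i) (allFin n)))) (∑-cong λ i → sum-map-allFin (row i))
  where
  row : Fin n → Fin n → ℕ
  row i j = ind (does (i <? j) ∧ G i j)

degree≡0⇒nonadjacent : ∀ {n} (G : Graph n) {v} → degree G v ≡ 0 → ∀ u → G v u ≡ false
degree≡0⇒nonadjacent G {v} deg≡0 u
  with G v u | ∑≡0⇒≡0 (ind ∘ G v) (trans (sym (sum-map-allFin (ind ∘ G v))) deg≡0) u
... | false | _  = refl
... | true  | ()

pairs≤edgeCount : ∀ {n} {G : Graph n} {P : Pred (Fin n) 0ℓ} (P? : Decidable P) →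
  (∀ {i j} → P i → P j → i Fin.< j → G i j ≡ true) → pairs P? ≤ edgeCount G
pairs≤edgeCount {G = G} {P} P? clique =
  subst (pairs P? ≤_) (sym (edgeCount≡∑ G)) (∑-mono-≤ λ i → ∑-mono-≤ (pair≤edge i))
  where
  pair≤edge : ∀ i j → ind (does (i <? j) ∧ (does (P? i) ∧ does (P? j))) ≤ ind (does (i <? j) ∧ G i j)
  pair≤edge i j = by-cases (i <? j) (P? i) (P? j)
    where
    by-cases : (i<j? : Dec (i Fin.< j)) → (Pi? : Dec (P i)) → (Pj? : Dec (P j)) →
      ind (does i<j? ∧ (does Pi? ∧ does Pj?)) ≤ ind (does i<j? ∧ G i j)
    by-cases (yes i<j) (yes Pi) (yes Pj) rewrite clique Pi Pj i<j = ≤-refl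
    by-cases (no  _)   _        _        = z≤n
    by-cases (yes _)   (no  _)  _        = z≤n
    by-cases (yes _)   (yes _)  (no  _)  = z≤n

nonEdges : ∀ {n} → Graph n → ℕ
nonEdges G = ∑ (λ i → ∑ (λ j → ind (does (i <? j) ∧ not (G i j))))

ind-∧-not-antitone : ∀ d {b c} → (b ≡ true → c ≡ true) → ind (d ∧ not c) ≤ ind (d ∧ not b)
ind-∧-not-antitone false         b⇒c = z≤n
ind-∧-not-antitone true {true}   b⇒c rewrite b⇒c refl = z≤n
ind-∧-not-antitone true {false} {true}  b⇒c = z≤n
ind-∧-not-antitone true {false} {false} b⇒c = ≤-refl

nonEdges-addEdge : ∀ {n} {G : Graph n} {u v} → Legal G u v → nonEdges (addEdge G u v) < nonEdges G
nonEdges-addEdge {G = G} {u} {v} (u<v , Guv≡false , _) =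
  ∑-mono-< (λ i → ∑-mono-≤ (antitone i)) u (∑-mono-< (antitone u) v new)
  where
  antitone : ∀ i j → ind (does (i <? j) ∧ not (addEdge G u v i j)) ≤ ind (does (i <? j) ∧ not (G i j))
  antitone i j = ind-∧-not-antitone (does (i <? j)) (addEdge-⊇ {G = G} u v)
  new : ind (does (u <? v) ∧ not (addEdge G u v u v)) < ind (does (u <? v) ∧ not (G u v))
  new rewrite dec-true (u <? v) u<v | addEdge-new {G = G} u v | Guv≡false = ≤-refl

module _ {n} (K : ℕ) (Inv : Graph n → Set)
  (legal? : ∀ {G} → Inv G → ∀ u v → Dec (Legal G u v))
  (Inv-step : ∀ {G u v} → Inv G → Legal G u v → Inv (addEdge G u v))
  (Inv-final : ∀ {G} → Inv G → Saturated G → K ≤ edgeCount G) where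

  private
    forcesWithin : ∀ bound {G} → nonEdges G < bound → Inv G → ∀ p → MaxForces K p G
    forcesWithin (suc bound) {G} nonEdges< inv p with any? (λ u → any? (λ v → legal? inv u v))
    ... | no noMove = done saturated (Inv-final inv saturated)
      where
      saturated : Saturated G
      saturated u v L = noMove (u , v , L)
    ... | yes (u , v , L) = move p
      where
      next : ∀ {u v} → Legal G u v → ∀ p → MaxForces K p (addEdge G u v)
      next L = forcesWithin bound (<-≤-trans (nonEdges-addEdge L) (s≤s⁻¹ nonEdges<)) (Inv-step inv L)
      move : ∀ p → MaxForces K p G
      move maxi = maxMove u v L (next L mini)
      move mini = miniMove (u , v , L) (λ _ _ L′ → next L′ maxi)

  maxForces-invariant : ∀ {G} → Inv G → ∀ p → MaxForces K p G
  maxForces-invariant {G} = forcesWithin (suc (nonEdges G)) ≤-refl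

-- Matchings of vertex subsets

record MatchingOn {n} (G : Graph n) (S : Pred (Fin n) 0ℓ) : Set where
  field
    partner    : Fin n → Fin n
    closed     : ∀ {v} → S v → S (partner v)
    involutive : ∀ {v} → S v → partner (partner v) ≡ v
    noFixed    : ∀ {v} → S v → partner v ≢ v
    adjacent   : ∀ {v} → S v → G v (partner v) ≡ true

OnPrefix : ∀ {n} → (ℕ → Fin n) → ℕ → Pred (Fin n) 0ℓ
OnPrefix g l v = ∃ λ t → t < l × g t ≡ v

module _ {n} {G : Graph n} where

  perfect : ∀ {S} → MatchingOn G S → (∀ v → S v) → PerfectMatching G
  perfect M all = record
    { partner    = partner
    ; involutive = λ v → involutive (all v)
    ; noFixed    = λ v → noFixed (all v)
    ; adjacent   = λ v → adjacent (all v)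
    }
    where open MatchingOn M

  MatchingOn-resp-⇔ : ∀ {S T} → S ⊆ T → T ⊆ S → MatchingOn G S → MatchingOn G T
  MatchingOn-resp-⇔ S⊆T T⊆S M = record
    { partner    = partner
    ; closed     = S⊆T ∘ closed ∘ T⊆S
    ; involutive = involutive ∘ T⊆S
    ; noFixed    = noFixed ∘ T⊆S
    ; adjacent   = adjacent ∘ T⊆S
    }
    where open MatchingOn M

  emptyMatching : ∀ {S} → (∀ {v} → ¬ S v) → MatchingOn G S
  emptyMatching ¬S = record
    { partner    = λ v → v
    ; closed     = ⊥-elim ∘ ¬S
    ; involutive = ⊥-elim ∘ ¬S
    ; noFixed    = ⊥-elim ∘ ¬S
    ; adjacent   = ⊥-elim ∘ ¬S
    }

  edgeMatching : Symmetric G → ∀ {a b} → a ≢ b → G a b ≡ true →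
    MatchingOn G (λ v → v ≡ a ⊎ v ≡ b)
  edgeMatching symG {a} {b} a≢b Gab = record
    { partner    = partner
    ; closed     = λ { (inj₁ refl) → inj₂ partner-a ; (inj₂ refl) → inj₁ partner-b }
    ; involutive = λ { (inj₁ refl) → trans (cong partner partner-a) partner-b
                     ; (inj₂ refl) → trans (cong partner partner-b) partner-a }
    ; noFixed    = λ { (inj₁ refl) e → a≢b (sym (trans (sym partner-a) e))
                     ; (inj₂ refl) e → a≢b (trans (sym partner-b) e) }
    ; adjacent   = λ { (inj₁ refl) → trans (cong (G a) partner-a) Gab
                     ; (inj₂ refl) → trans (cong (G b) partner-b) (trans (symG b a) Gab) }
    }
    where
    partner : Fin n → Fin n
    partner v = if does (v ≟ a) then b else a
    partner-a : partner a ≡ b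
    partner-a rewrite dec-true (a ≟ a) refl = refl
    partner-b : partner b ≡ a
    partner-b rewrite dec-false (b ≟ a) (a≢b ∘ sym) = refl

  union : ∀ {S T} → Decidable S → (∀ {v} → S v → ¬ T v) →
    MatchingOn G S → MatchingOn G T → MatchingOn G (λ v → S v ⊎ T v)
  union {S} {T} S? disjoint M N = record
    { partner    = partner
    ; closed     = λ { (inj₁ s) → inj₁ (subst S (sym (on-S s)) (M.closed s))
                     ; (inj₂ t) → inj₂ (subst T (sym (on-T t)) (N.closed t)) }
    ; involutive = λ { (inj₁ s) → trans (cong partner (on-S s)) (trans (on-S (M.closed s)) (M.involutive s))
                     ; (inj₂ t) → trans (cong partner (on-T t)) (trans (on-T (N.closed t)) (N.involutive t)) }
    ; noFixed    = λ { (inj₁ s) → M.noFixed s ∘ trans (sym (on-S s))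
                     ; (inj₂ t) → N.noFixed t ∘ trans (sym (on-T t)) }
    ; adjacent   = λ { {v} (inj₁ s) → trans (cong (G v) (on-S s)) (M.adjacent s)
                     ; {v} (inj₂ t) → trans (cong (G v) (on-T t)) (N.adjacent t) }
    }
    where
    module M = MatchingOn M
    module N = MatchingOn N
    partner : Fin n → Fin n
    partner v = if does (S? v) then M.partner v else N.partner v
    on-S : ∀ {v} → S v → partner v ≡ M.partner v
    on-S {v} s rewrite dec-true (S? v) s = refl
    on-T : ∀ {v} → T v → partner v ≡ N.partner v
    on-T {v} t rewrite dec-false (S? v) (λ s → disjoint s t) = refl

  prefixMatching : Symmetric G → ∀ m (g : ℕ → Fin n) → (∀ t → G (g t) (g (suc t)) ≡ true) →
    (∀ {s t} → s < m * 2 → t < m * 2 → g s ≡ g t → s ≡ t) → MatchingOn G (OnPrefix g (m * 2))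
  prefixMatching symG zero    g step inj = emptyMatching λ { (_ , () , _) }
  prefixMatching symG (suc m) g step inj =
    MatchingOn-resp-⇔ to-prefix from-prefix
      (union (λ v → v ≟ g 0 ⊎-dec v ≟ g 1) disjoint
        (edgeMatching symG (λ e → case inj z<s (s≤s z<s) e of λ ()) (step 0))
        (prefixMatching symG m (g ∘ (2 +_)) (step ∘ (2 +_))
          λ s< t< e → suc-injective (suc-injective (inj (s≤s (s≤s s<)) (s≤s (s≤s t<)) e))))
    where
    disjoint : ∀ {v} → v ≡ g 0 ⊎ v ≡ g 1 → ¬ OnPrefix (g ∘ (2 +_)) (m * 2) v
    disjoint (inj₁ refl) (t , t< , e) = case inj (s≤s (s≤s t<)) z<s e of λ ()
    disjoint (inj₂ refl) (t , t< , e) = case inj (s≤s (s≤s t<)) (s≤s z<s) e of λ ()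
    to-prefix : (λ v → (v ≡ g 0 ⊎ v ≡ g 1) ⊎ OnPrefix (g ∘ (2 +_)) (m * 2) v) ⊆ OnPrefix g (suc m * 2)
    to-prefix (inj₁ (inj₁ refl))   = 0 , z<s , refl
    to-prefix (inj₁ (inj₂ refl))   = 1 , s≤s z<s , refl
    to-prefix (inj₂ (t , t< , e)) = suc (suc t) , s≤s (s≤s t<) , e
    from-prefix : OnPrefix g (suc m * 2) ⊆ (λ v → (v ≡ g 0 ⊎ v ≡ g 1) ⊎ OnPrefix (g ∘ (2 +_)) (m * 2) v)
    from-prefix (zero , _ , refl)          = inj₁ (inj₁ refl)
    from-prefix (suc zero , _ , refl)      = inj₁ (inj₂ refl)
    from-prefix (suc (suc t) , t< , e)     = inj₂ (t , s≤s⁻¹ (s≤s⁻¹ t<) , e)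

-- Windows of a cycle read periodically

module _ (N : ℕ) .{{_ : NonZero N}} where

  %-injective-window : ∀ {x y} → x ≤ y → y < x + N → x % N ≡ y % N → x ≡ y
  %-injective-window {x} {y} x≤y y<x+N x%≡y% = begin-equality
    x                  ≡⟨ m≡m%n+[m/n]*n x N ⟩
    x % N + x / N * N  ≡⟨ cong₂ _+_ x%≡y% (cong (_* N) x/≡y/) ⟩
    y % N + y / N * N  ≡⟨ sym (m≡m%n+[m/n]*n y N) ⟩
    y                  ∎
    where
    open ≤-Reasoning
    y/*N<1+x/*N : y / N * N < suc (x / N) * N
    y/*N<1+x/*N = +-cancelˡ-< (x % N) _ _ (begin-strict
      x % N + y / N * N       ≡⟨ cong (_+ y / N * N) x%≡y% ⟩
      y % N + y / N * N       ≡⟨ sym (m≡m%n+[m/n]*n y N) ⟩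
      y                       <⟨ y<x+N ⟩
      x + N                   ≡⟨ cong (_+ N) (m≡m%n+[m/n]*n x N) ⟩
      x % N + x / N * N + N   ≡⟨ +-assoc (x % N) _ N ⟩
      x % N + (x / N * N + N) ≡⟨ cong (x % N +_) (+-comm (x / N * N) N) ⟩
      x % N + suc (x / N) * N ∎)
    x/≡y/ : x / N ≡ y / N
    x/≡y/ = ≤-antisym (/-monoˡ-≤ N x≤y) (m<1+n⇒m≤n (*-cancelʳ-< N _ _ y/*N<1+x/*N))

  private
    %-injective-shift-≤ : ∀ c {s t} → s ≤ t → t < N → (c + s) % N ≡ (c + t) % N → s ≡ t
    %-injective-shift-≤ c {s} s≤t t<N e = +-cancelˡ-≡ c _ _
      (%-injective-window (+-monoʳ-≤ c s≤t) (<-≤-trans (+-monoʳ-< c t<N) (+-monoˡ-≤ N (m≤m+n c s))) e)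

  %-injective-shift : ∀ c {s t} → s < N → t < N → (c + s) % N ≡ (c + t) % N → s ≡ t
  %-injective-shift c {s} {t} s<N t<N e with ≤-total s t
  ... | inj₁ s≤t = %-injective-shift-≤ c s≤t t<N e
  ... | inj₂ t≤s = sym (%-injective-shift-≤ c t≤s s<N (sym e))

  %-onto-shift : ∀ {c p} → c < N → p < N → ∃ λ t → t < N × (c + t) % N ≡ p
  %-onto-shift {c} {p} c<N p<N with c ≤? p
  ... | yes c≤p = p ∸ c , ≤-<-trans (m∸n≤m p c) p<N ,
                  trans (cong (_% N) (m+[n∸m]≡n c≤p)) (m<n⇒m%n≡m p<N)
  ... | no  c≰p = p + (N ∸ c) , subst (p + (N ∸ c) <_) c+[N∸c]≡N (+-monoˡ-< (N ∸ c) (≰⇒> c≰p)) ,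
    (begin
      (c + (p + (N ∸ c))) % N ≡⟨ cong (_% N) (x∙yz≈y∙xz c p (N ∸ c)) ⟩
      (p + (c + (N ∸ c))) % N ≡⟨ cong (λ m → (p + m) % N) c+[N∸c]≡N ⟩
      (p + N) % N             ≡⟨ [m+n]%n≡m%n p N ⟩
      p % N                   ≡⟨ m<n⇒m%n≡m p<N ⟩
      p                       ∎)
    where
    open ≡-Reasoning
    c+[N∸c]≡N : c + (N ∸ c) ≡ N
    c+[N∸c]≡N = m+[n∸m]≡n (<⇒≤ c<N)

%-suc : ∀ j N .{{_ : NonZero N}} → suc j % N ≡ suc (j % N) % N
%-suc j N = begin
  suc j % N                         ≡⟨ cong (λ m → suc m % N) (m≡m%n+[m/n]*n j N) ⟩
  (suc (j % N) + j / N * N) % N     ≡⟨ [m+kn]%n≡m%n (suc (j % N)) (j / N) N ⟩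
  suc (j % N) % N                   ∎
  where open ≡-Reasoning

module UnrolledCycle {n k} {G : Graph n} (h : Fin (suc k) → Fin n)
  (path : ∀ (i : Fin k) → G (h (inject₁ i)) (h (suc i)) ≡ true)
  (close : G (h (fromℕ k)) (h zero) ≡ true) where

  private
    mod-≡ : ∀ j {i : Fin (suc k)} → j % suc k ≡ toℕ i → j mod suc k ≡ i
    mod-≡ j e = toℕ-injective (trans (toℕ-fromℕ< _) e)

  -- Reading h periodically makes every arc of the cycle a window of consecutive indices.
  at : ℕ → Fin n
  at j = h (j mod suc k)

  at-toℕ : ∀ i → at (toℕ i) ≡ h i
  at-toℕ i = cong h (mod-≡ (toℕ i) (m<n⇒m%n≡m (toℕ<n i)))

  at-step : ∀ j → G (at j) (at (suc j)) ≡ true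
  at-step j with j % suc k ℕₚ.≟ k
  ... | yes r≡k = subst₂ (λ u v → G (h u) (h v) ≡ true) (sym j-last) (sym sj-first) close
    where
    j-last : j mod suc k ≡ fromℕ k
    j-last = mod-≡ j (trans r≡k (sym (toℕ-fromℕ k)))
    sj-first : suc j mod suc k ≡ zero
    sj-first = mod-≡ (suc j) (trans (%-suc j (suc k)) (trans (cong (λ r → suc r % suc k) r≡k) (n%n≡0 (suc k))))
  ... | no  r≢k = subst₂ (λ u v → G (h u) (h v) ≡ true) (sym j-inner) (sym sj-next) (path i)
    where
    r<k : j % suc k < k
    r<k = ≤∧≢⇒< (m<1+n⇒m≤n (m%n<n j (suc k))) r≢k
    i : Fin k
    i = fromℕ< r<k
    j-inner : j mod suc k ≡ inject₁ i
    j-inner = mod-≡ j (trans (sym (toℕ-fromℕ< r<k)) (sym (toℕ-inject₁ i)))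
    sj-next : suc j mod suc k ≡ suc i
    sj-next = mod-≡ (suc j) (trans (%-suc j (suc k)) (trans (m<n⇒m%n≡m (s≤s r<k)) (cong suc (sym (toℕ-fromℕ< r<k)))))

  at-injective-shift : Injective _≡_ _≡_ h → ∀ c {s t} → s < suc k → t < suc k →
    at (c + s) ≡ at (c + t) → s ≡ t
  at-injective-shift inj c s< t< e =
    %-injective-shift (suc k) c s< t< (trans (sym (toℕ-fromℕ< _)) (trans (cong toℕ (inj e)) (toℕ-fromℕ< _)))

  at-onto-shift : ∀ (i p : Fin (suc k)) → ∃ λ t → t < suc k × at (toℕ i + t) ≡ h p
  at-onto-shift i p with %-onto-shift (suc k) (toℕ<n i) (toℕ<n p)
  ... | t , t< , e = t , t< , cong h (mod-≡ (toℕ i + t) e)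

module Configuration {n} (G₀ : Graph n) (symG₀ : Symmetric G₀) (x y z : Fin n)
  (x≢y : x ≢ y) (x≢z : x ≢ z) (y≢z : y ≢ z) (Gxy : G₀ x y ≡ true)
  (H : HamCycleAvoiding G₀ x y z) where

  open HamCycleAvoiding H

  InW : Fin n → Set
  InW v = v ≢ x × v ≢ y × v ≢ z

  InW? : ∀ v → Dec (InW v)
  InW? v = ¬? (v ≟ x) ×-dec ¬? (v ≟ y) ×-dec ¬? (v ≟ z)

  vertex-cases : ∀ v → v ≡ x ⊎ v ≡ y ⊎ v ≡ z ⊎ InW v
  vertex-cases v with v ≟ x | v ≟ y | v ≟ z
  ... | yes v≡x | _       | _       = inj₁ v≡x
  ... | no  v≢x | yes v≡y | _       = inj₂ (inj₁ v≡y)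
  ... | no  v≢x | no  v≢y | yes v≡z = inj₂ (inj₂ (inj₁ v≡z))
  ... | no  v≢x | no  v≢y | no  v≢z = inj₂ (inj₂ (inj₂ (v≢x , v≢y , v≢z)))

  count-W : count InW? ≡ suc k
  count-W = count-image (suc k) InW? h (λ {i} {j} → inj i j) avoid (λ (p , q , r) → cover _ p q r)

  n≡|W|+3 : n ≡ 3 + count InW?
  n≡|W|+3 = begin
    n                                ≡⟨ sym (count-full n) ⟩
    count all?                       ≡⟨ count-remove all? tt ⟩
    suc (count (all? ∖? x))          ≡⟨ cong suc (count-remove (all? ∖? x) (tt , x≢y ∘ sym)) ⟩
    2 + count (all? ∖? x ∖? y)       ≡⟨ cong (2 +_) (count-remove (all? ∖? x ∖? y) ((tt , x≢z ∘ sym) , y≢z ∘ sym)) ⟩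
    3 + count (all? ∖? x ∖? y ∖? z)  ≡⟨ cong (3 +_) (count-cong (all? ∖? x ∖? y ∖? z) InW? unnest nest) ⟩
    3 + count InW?                   ∎
    where
    open ≡-Reasoning
    unnest : ∀ {v} → ((⊤ × v ≢ x) × v ≢ y) × v ≢ z → InW v
    unnest (((_ , p) , q) , r) = p , q , r
    nest : ∀ {v} → InW v → ((⊤ × v ≢ x) × v ≢ y) × v ≢ z
    nest (p , q , r) = ((tt , p) , q) , r
    all? : ∀ (v : Fin n) → Dec ⊤
    all? _ = yes tt

  k-even : 2 ∣ n → 2 ∣ k
  k-even 2∣n = ∣m+n∣m⇒∣n (subst (2 ∣_) (trans n≡|W|+3 (cong (3 +_) count-W)) 2∣n) (divides 2 refl)

  Extends : Graph n → Set
  Extends G = ∀ {i j} → G₀ i j ≡ true → G i j ≡ true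

  open UnrolledCycle {G = G₀} h path close

  module _ {G : Graph n} (symG : Symmetric G) (ext : Extends G) where

    -- Deleting w from the odd cycle h leaves a path with an even number of vertices.
    matching-W∖ : 2 ∣ k → ∀ {w} → InW w → MatchingOn G (λ v → InW v × v ≢ w)
    matching-W∖ (divides m k≡m*2) {w} (w≢x , w≢y , w≢z) with cover w w≢x w≢y w≢z
    ... | i₀ , refl =
      MatchingOn-resp-⇔ into onto (prefixMatching symG m g step g-injective)
      where
      c : ℕ
      c = toℕ i₀
      g : ℕ → Fin n
      g t = at (c + suc t)
      step : ∀ t → G (g t) (g (suc t)) ≡ true
      step t = ext (subst (λ j → G₀ (g t) (at j) ≡ true) (sym (+-suc c (suc t))) (at-step (c + suc t)))
      lift< : ∀ {t} → t < m * 2 → suc t < suc k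
      lift< t< = s≤s (subst (_ <_) (sym k≡m*2) t<)
      at-injective : ∀ {s t} → s < suc k → t < suc k → at (c + s) ≡ at (c + t) → s ≡ t
      at-injective = at-injective-shift (λ {i} {j} → inj i j) c
      g-injective : ∀ {s t} → s < m * 2 → t < m * 2 → g s ≡ g t → s ≡ t
      g-injective s< t< e = suc-injective (at-injective (lift< s<) (lift< t<) e)
      w≡at-c+0 : h i₀ ≡ at (c + 0)
      w≡at-c+0 = trans (sym (at-toℕ i₀)) (cong at (sym (+-identityʳ c)))
      into : ∀ {v} → OnPrefix g (m * 2) v → InW v × v ≢ h i₀
      into (t , t< , refl) = avoid _ , λ e → case at-injective (lift< t<) (s≤s z≤n) (trans e w≡at-c+0) of λ ()
      onto : ∀ {v} → InW v × v ≢ h i₀ → OnPrefix g (m * 2) v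
      onto ((p , q , r) , v≢w) with cover _ p q r
      ... | i , refl with at-onto-shift i₀ i
      ... | zero  , _    , e = contradiction (trans (sym e) (sym w≡at-c+0)) v≢w
      ... | suc t , t<1+k , e = t , subst (t <_) k≡m*2 (s≤s⁻¹ t<1+k) , e

    hasPM-via : 2 ∣ k → ∀ {a b c w} →
      (∀ {v} → v ≢ a × v ≢ b × v ≢ c → InW v) → (∀ {v} → InW v → v ≢ a × v ≢ b × v ≢ c) →
      a ≢ b → a ≢ c → b ≢ c → G a b ≡ true → G c w ≡ true → InW w → HasPM G
    hasPM-via 2∣k {a} {b} {c} {w} toW fromW a≢b a≢c b≢c Gab Gcw w∈W =
      perfect (union (λ v → v ≟ a ⊎-dec v ≟ b) ab-disjoint (edgeMatching symG a≢b Gab)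
                (union (λ v → v ≟ c ⊎-dec v ≟ w) cw-disjoint
                  (edgeMatching symG (w≢c ∘ sym) Gcw) (matching-W∖ 2∣k w∈W)))
              covered
      where
      w≢a : w ≢ a
      w≢a = proj₁ (fromW w∈W)
      w≢b : w ≢ b
      w≢b = proj₁ (proj₂ (fromW w∈W))
      w≢c : w ≢ c
      w≢c = proj₂ (proj₂ (fromW w∈W))
      ab-disjoint : ∀ {v} → v ≡ a ⊎ v ≡ b → ¬ ((v ≡ c ⊎ v ≡ w) ⊎ (InW v × v ≢ w))
      ab-disjoint (inj₁ refl) (inj₁ (inj₁ a≡c)) = a≢c a≡c
      ab-disjoint (inj₁ refl) (inj₁ (inj₂ a≡w)) = w≢a (sym a≡w)
      ab-disjoint (inj₁ refl) (inj₂ (a∈W , _))  = proj₁ (fromW a∈W) refl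
      ab-disjoint (inj₂ refl) (inj₁ (inj₁ b≡c)) = b≢c b≡c
      ab-disjoint (inj₂ refl) (inj₁ (inj₂ b≡w)) = w≢b (sym b≡w)
      ab-disjoint (inj₂ refl) (inj₂ (b∈W , _))  = proj₁ (proj₂ (fromW b∈W)) refl
      cw-disjoint : ∀ {v} → v ≡ c ⊎ v ≡ w → ¬ (InW v × v ≢ w)
      cw-disjoint (inj₁ refl) (c∈W , _) = proj₂ (proj₂ (fromW c∈W)) refl
      cw-disjoint (inj₂ refl) (_ , w≢w) = w≢w refl
      covered : ∀ v → (v ≡ a ⊎ v ≡ b) ⊎ ((v ≡ c ⊎ v ≡ w) ⊎ (InW v × v ≢ w))
      covered v with InW? v | v ≟ w
      ... | yes v∈W | yes v≡w = inj₂ (inj₁ (inj₂ v≡w))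
      ... | yes v∈W | no  v≢w = inj₂ (inj₂ (v∈W , v≢w))
      ... | no  v∉W | _ with v ≟ a | v ≟ b | v ≟ c
      ... | yes v≡a | _       | _       = inj₁ (inj₁ v≡a)
      ... | no  _   | yes v≡b | _       = inj₁ (inj₂ v≡b)
      ... | no  _   | no  _   | yes v≡c = inj₂ (inj₁ (inj₁ v≡c))
      ... | no  v≢a | no  v≢b | no  v≢c = contradiction (toW (v≢a , v≢b , v≢c)) v∉W

  WNeighbour : Graph n → Fin n → Set
  WNeighbour G r = ∃ λ w → InW w × G r w ≡ true

  -- The ways z can be matched without stranding x or y.
  ZMatchable : Graph n → Set
  ZMatchable G = WNeighbour G z ⊎ (G z x ≡ true × WNeighbour G y) ⊎ (G z y ≡ true × WNeighbour G x)

  hasPM-of-zMatchable : ∀ {G} → Symmetric G → Extends G → 2 ∣ k → ZMatchable G → HasPM G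
  hasPM-of-zMatchable symG ext 2∣k (inj₁ (w , w∈W , Gzw)) =
    hasPM-via symG ext 2∣k (λ t → t) (λ t → t) x≢y x≢z y≢z (ext Gxy) Gzw w∈W
  hasPM-of-zMatchable symG ext 2∣k (inj₂ (inj₁ (Gzx , w , w∈W , Gyw))) =
    hasPM-via symG ext 2∣k (λ (p , q , r) → q , r , p) (λ (p , q , r) → r , p , q)
      (x≢z ∘ sym) (y≢z ∘ sym) x≢y Gzx Gyw w∈W
  hasPM-of-zMatchable symG ext 2∣k (inj₂ (inj₂ (Gzy , w , w∈W , Gxw))) =
    hasPM-via symG ext 2∣k (λ (p , q , r) → r , q , p) (λ (p , q , r) → r , q , p)
      (y≢z ∘ sym) (x≢z ∘ sym) (x≢y ∘ sym) Gzy Gxw w∈W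

  module _ {G : Graph n} (M : HasPM G) where
    open PerfectMatching M renaming (partner to p)

    private
      swap : ∀ {u v} → p u ≡ v → p v ≡ u
      swap {u} refl = involutive u
      adjacent-to : ∀ {u v} → p u ≡ v → G u v ≡ true
      adjacent-to {u} refl = adjacent u

    zMatchable-of-hasPM : ZMatchable G
    zMatchable-of-hasPM with vertex-cases (p z)
    ... | inj₂ (inj₂ (inj₂ pz∈W)) = inj₁ (p z , pz∈W , adjacent z)
    ... | inj₂ (inj₂ (inj₁ pz≡z)) = contradiction pz≡z (noFixed z)
    ... | inj₁ pz≡x with vertex-cases (p y)
    ...   | inj₂ (inj₂ (inj₂ py∈W)) = inj₂ (inj₁ (adjacent-to pz≡x , p y , py∈W , adjacent y))
    ...   | inj₁ py≡x               = contradiction (trans (sym (swap py≡x)) (swap pz≡x)) y≢z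
    ...   | inj₂ (inj₁ py≡y)        = contradiction py≡y (noFixed y)
    ...   | inj₂ (inj₂ (inj₁ py≡z)) = contradiction (trans (sym pz≡x) (swap py≡z)) x≢y
    zMatchable-of-hasPM | inj₂ (inj₁ pz≡y) with vertex-cases (p x)
    ...   | inj₂ (inj₂ (inj₂ px∈W)) = inj₂ (inj₂ (adjacent-to pz≡y , p x , px∈W , adjacent x))
    ...   | inj₁ px≡x               = contradiction px≡x (noFixed x)
    ...   | inj₂ (inj₁ px≡y)        = contradiction (trans (sym (swap px≡y)) (swap pz≡y)) x≢z
    ...   | inj₂ (inj₂ (inj₁ px≡z)) = contradiction (trans (sym (swap px≡z)) pz≡y) x≢y

  zMatchable-addEdge⁻ : ∀ {G i j} → InW i → InW j → ZMatchable (addEdge G i j) → ZMatchable G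
  zMatchable-addEdge⁻ {G} {i} {j} (i≢x , i≢y , i≢z) (j≢x , j≢y , j≢z) = λ where
      (inj₁ nz)                → inj₁ (neighbour z-row nz)
      (inj₂ (inj₁ (Gzx , ny))) → inj₂ (inj₁ (trans (sym (z-row x)) Gzx , neighbour y-row ny))
      (inj₂ (inj₂ (Gzy , nx))) → inj₂ (inj₂ (trans (sym (z-row y)) Gzy , neighbour x-row nx))
    where
    Unchanged : Fin n → Set
    Unchanged r = ∀ s → addEdge G i j r s ≡ G r s
    z-row : Unchanged z
    z-row = addEdge-row {G = G} (i≢z ∘ sym) (j≢z ∘ sym)
    y-row : Unchanged y
    y-row = addEdge-row {G = G} (i≢y ∘ sym) (j≢y ∘ sym)
    x-row : Unchanged x
    x-row = addEdge-row {G = G} (i≢x ∘ sym) (j≢x ∘ sym)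
    neighbour : ∀ {r} → Unchanged r → WNeighbour (addEdge G i j) r → WNeighbour G r
    neighbour row (w , w∈W , e) = w , w∈W , trans (sym (row w)) e

  zMatchable? : ∀ G → Dec (ZMatchable G)
  zMatchable? G =
    neighbour? z ⊎-dec (G z x Boolₚ.≟ true ×-dec neighbour? y) ⊎-dec (G z y Boolₚ.≟ true ×-dec neighbour? x)
    where
    neighbour? : ∀ r → Dec (WNeighbour G r)
    neighbour? r = any? λ w → InW? w ×-dec G r w Boolₚ.≟ true

  extends-addEdge : ∀ {G} → Extends G → ∀ u v → Extends (addEdge G u v)
  extends-addEdge {G} ext u v e = addEdge-⊇ {G = G} u v (ext e)

  Position : Graph n → Set
  Position G = Symmetric G × Extends G × ¬ HasPM G

  module _ (2∣k : 2 ∣ k) where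

    legal? : ∀ {G} → Position G → ∀ u v → Dec (Legal G u v)
    legal? {G} (symG , ext , _) u v = u <? v ×-dec G u v Boolₚ.≟ false ×-dec ¬? hasPM?
      where
      hasPM? : Dec (HasPM (addEdge G u v))
      hasPM? = map′ (hasPM-of-zMatchable (addEdge-symmetric symG u v) (extends-addEdge ext u v) 2∣k)
                    zMatchable-of-hasPM (zMatchable? _)

    position-step : ∀ {G u v} → Position G → Legal G u v → Position (addEdge G u v)
    position-step {G} {u} {v} (symG , ext , _) (_ , _ , noPM) =
      addEdge-symmetric symG u v , extends-addEdge ext u v , noPM

    W-clique : ∀ {G} → Position G → Saturated G → ∀ {i j} → InW i → InW j → i ≢ j → G i j ≡ true
    W-clique {G} (symG , ext , noPM) saturated {i} {j} i∈W j∈W i≢j = ¬-not nonEdge-absurd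
      where
      nonEdge-legal : ∀ {i j} → InW i → InW j → i Fin.< j → G i j ≡ false → Legal G i j
      nonEdge-legal i∈W j∈W i<j Gij≡false = i<j , Gij≡false ,
        noPM ∘ hasPM-of-zMatchable symG ext 2∣k ∘ zMatchable-addEdge⁻ i∈W j∈W ∘ zMatchable-of-hasPM
      nonEdge-absurd : G i j ≢ false
      nonEdge-absurd Gij≡false with <-cmp i j
      ... | tri< i<j _ _ = saturated i j (nonEdge-legal i∈W j∈W i<j Gij≡false)
      ... | tri≈ _ i≡j _ = i≢j i≡j
      ... | tri> _ _ j<i = saturated j i (nonEdge-legal j∈W i∈W j<i (trans (symG j i) Gij≡false))

    saturated-bound : ∀ {G} → Position G → Saturated G → (n ∸ 3) C 2 ≤ edgeCount G
    saturated-bound pos saturated = subst (_≤ _) (cong (_C 2) |W|≡n∸3)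
      (subst (_≤ _) (pairs≡countC2 InW?)
        (pairs≤edgeCount InW? λ i∈W j∈W i<j → W-clique pos saturated i∈W j∈W (<⇒≢ i<j)))
      where
      |W|≡n∸3 : count InW? ≡ n ∸ 3
      |W|≡n∸3 = sym (trans (cong (_∸ 3) n≡|W|+3) (m+n∸m≡n 3 _))

  isolated-z-position : (∀ v → G₀ z v ≡ false) → Position G₀
  isolated-z-position z-isolated = symG₀ , (λ e → e) , noPM
    where
    z-edge : ∀ {v} → G₀ z v ≢ true
    z-edge {v} e = contradiction (trans (sym e) (z-isolated v)) λ ()
    noPM : ¬ HasPM G₀
    noPM M with zMatchable-of-hasPM M
    ... | inj₁ (_ , _ , Gzw)    = z-edge Gzw
    ... | inj₂ (inj₁ (Gzx , _)) = z-edge Gzx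
    ... | inj₂ (inj₂ (Gzy , _)) = z-edge Gzy

  maxForces : 2 ∣ n → ∀ {G} → Position G → ∀ p → MaxForces ((n ∸ 3) C 2) p G
  maxForces 2∣n = maxForces-invariant _ Position (legal? 2∣k) (position-step 2∣k) (saturated-bound 2∣k)
    where 2∣k = k-even 2∣n

lemma4p2 : (n : ℕ) → 6 ≤ n → 2 ∣ n →
    (G₀ : Graph n) → Symmetric G₀ → Irreflexive G₀ →
    (x y z : Fin n) → G₀ x y ≡ true →
    degree G₀ x ≡ 1 → degree G₀ y ≡ 1 → degree G₀ z ≡ 0 →
    HamCycleAvoiding G₀ x y z →
    ScoreAtLeast mini G₀ ((n ∸ 3) C 2)
lemma4p2 n _ 2∣n G₀ symG₀ irrG₀ x y z Gxy _ _ deg-z H =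
  maxForces 2∣n (isolated-z-position z-isolated) mini
  where
  z-isolated : ∀ v → G₀ z v ≡ false
  z-isolated = degree≡0⇒nonadjacent G₀ deg-z
  x≢y : x ≢ y
  x≢y refl = contradiction (trans (sym Gxy) (irrG₀ x)) λ ()
  x≢z : x ≢ z
  x≢z refl = contradiction (trans (sym Gxy) (z-isolated y)) λ ()
  y≢z : y ≢ z
  y≢z refl = contradiction (trans (sym Gxy) (trans (symG₀ x y) (z-isolated x))) λ ()
  open Configuration G₀ symG₀ x y z x≢y x≢z y≢z Gxy H
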